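{- Let $p$ be a prime with $p \equiv 5$ or $7 \pmod 8$ and let $\varepsilon \in \{1, -1\}$. A pair $(X, Y)$ with $X, Y \in M_2(\mathbb{Z})$ satisfies $X^2 + 2Y^2 = \varepsilon p I$ if and only if it has one of the following forms: (i) $X = \begin{pmatrix} t_1 & t_2 \\ t_3 & -t_1 \end{pmatrix}$, $Y = \begin{pmatrix} s_1 & s_2 \\ s_3 & -s_1 \end{pmatrix}$ with $t_1, t_2, t_3, s_1, s_2, s_3 \in \mathbb{Z}$ and $t_1^2 + t_2 t_3 + 2(s_1^2 + s_2 s_3) = \varepsilon p$; (ii) $X = t_1 I$, $Y = \begin{pmatrix} t_4 & t_2 \\ t_3 & -t_4 \end{pmatrix}$ with $t_1, t_2, t_3, t_4 \in \mathbb{Z}$ and $t_1^2 + 2(t_4^2 + t_2 t_3) = \varepsilon p$; (iii) $X = \begin{pmatrix} t_1 & t_2 \\ t_3 & -t_1 \end{pmatrix}$, $Y = t_4 I$ with $t_1, t_2, t_3, t_4 \in \mathbb{Z}$ and $t_1^2 + t_2 t_3 + 2 t_4^2 = \varepsilon p$.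
   Context: $M_2(\mathbb{Z})$ denotes the ring of $2\times 2$ matrices with integer entries; $I$ is the $2\times 2$ identity matrix. -}

module Defs where

open import Data.Integer using (ℤ; _+_; _*_; -_; +_)
open import Data.Product using (Σ; _×_; ∃-syntax)
open import Data.Sum using (_⊎_)
open import Relation.Binary.PropositionalEquality using (_≡_)

record M₂ : Set where
  constructor mat
  field
    a b c d : ℤ

open M₂ public

_⊕_ : M₂ → M₂ → M₂
mat a₁ b₁ c₁ d₁ ⊕ mat a₂ b₂ c₂ d₂ = mat (a₁ + a₂) (b₁ + b₂) (c₁ + c₂) (d₁ + d₂)

_⊗_ : M₂ → M₂ → M₂
mat a₁ b₁ c₁ d₁ ⊗ mat a₂ b₂ c₂ d₂ =
  mat (a₁ * a₂ + b₁ * c₂) (a₁ * b₂ + b₁ * d₂)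
      (c₁ * a₂ + d₁ * c₂) (c₁ * b₂ + d₁ * d₂)

scalarI : ℤ → M₂
scalarI t = mat t (+ 0) (+ 0) t

_·_ : ℤ → M₂ → M₂
k · mat a₁ b₁ c₁ d₁ = mat (k * a₁) (k * b₁) (k * c₁) (k * d₁)

sq : M₂ → M₂
sq X = X ⊗ X

tl : ℤ → ℤ → ℤ → M₂
tl t₁ t₂ t₃ = mat t₁ t₂ t₃ (- t₁)

FormI : ℤ → M₂ → M₂ → Set
FormI e X Y = ∃[ t₁ ] ∃[ t₂ ] ∃[ t₃ ] ∃[ s₁ ] ∃[ s₂ ] ∃[ s₃ ]
  (X ≡ tl t₁ t₂ t₃ × Y ≡ tl s₁ s₂ s₃ ×
   t₁ * t₁ + t₂ * t₃ + + 2 * (s₁ * s₁ + s₂ * s₃) ≡ e)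

FormII : ℤ → M₂ → M₂ → Set
FormII e X Y = ∃[ t₁ ] ∃[ t₂ ] ∃[ t₃ ] ∃[ t₄ ]
  (X ≡ scalarI t₁ × Y ≡ tl t₄ t₂ t₃ ×
   t₁ * t₁ + + 2 * (t₄ * t₄ + t₂ * t₃) ≡ e)

FormIII : ℤ → M₂ → M₂ → Set
FormIII e X Y = ∃[ t₁ ] ∃[ t₂ ] ∃[ t₃ ] ∃[ t₄ ]
  (X ≡ tl t₁ t₂ t₃ × Y ≡ scalarI t₄ ×
   t₁ * t₁ + t₂ * t₃ + + 2 * (t₄ * t₄) ≡ e)

{-# OPTIONS --safe #-}
module Submission where

-- Write T = a + d and S = e + h for the traces of X = (a b; c d) and Y = (e f; g h).
-- Comparing entries of X² + 2Y² = N·I gives T·b + 2S·f = T·c + 2S·g = T·(a − d) + 2S·(e − h) = 0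
-- (equivalently, by Cayley–Hamilton, T·X + 2S·Y is scalar). If T = 0 or S = 0 these relations
-- force one of the three forms. If T, S ≠ 0, squaring them gives T²·Δ(X) = 4S²·Δ(Y) for the
-- discriminants Δ = tr² − 4 det, and with the trace of the equation this makes T² + 2S² divide
-- both 8N·T² and 8N·S². Cancelling gcd(T, S)² leaves α² + 2β² ∣ 8p with α, β ≠ 0, so
-- α² + 2β² = 2ʲ or 2ʲp. As x² + 2y² even forces x even, halving reduces this to x² + 2y² = 1
-- with x, y ≠ 0, which is too small, or to x² + 2y² = p, which is impossible modulo 8.

open import Defs
open import Data.Nat using (ℕ; _%_)
open import Data.Nat.Primality using (Prime)
open import Data.Product using (_×_; _,_; ∃-syntax)
open import Data.Sum using (_⊎_; inj₁; inj₂; [_,_]′)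
open import Data.Empty using (⊥; ⊥-elim)
open import Data.List using (_∷_; [])
open import Function using (id; _$_)
open import Function.Bundles using (_⇔_; mk⇔)
open import Relation.Nullary using (¬_; Dec; yes; no; contradiction)
open import Relation.Binary.PropositionalEquality
  using (_≡_; _≢_; refl; sym; trans; cong; cong₂; subst; subst₂; module ≡-Reasoning)

module QuadraticForm where

  open import Data.Nat
  open import Data.Nat.Properties
  open import Data.Nat.DivMod using (_mod_; m/n*n≡m; m≡m%n+[m/n]*n; [m+kn]%n≡m%n; m%n<n)
  open import Data.Nat.Divisibility
    using (_∣_; divides; _∣?_; ∣⇒≤; ∣m+n∣m⇒∣n; m∣m*n; ∣-trans; *-cancelʳ-∣)
  open import Data.Nat.GCD using (gcd; gcd[m,n]∣m; gcd[m,n]∣n; gcd[m,n]≢0)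
  open import Data.Nat.Coprimality as Coprimality
    using (Coprime; coprime-divisor; coprime-factors; coprime-/gcd)
  open import Data.Nat.Primality using (prime?; euclidsLemma; prime⇒irreducible; prime⇒nonZero)
  open import Data.Nat.Tactic.RingSolver using (solve-∀)
  open import Data.Fin using (Fin; toℕ)
  open import Data.Fin.Properties using (all?; toℕ-fromℕ<)
  open import Data.Sum using (reduce)
  open import Relation.Nullary using (¬?)
  open import Relation.Nullary.Decidable using (_⊎-dec_; from-yes; from-no)
  open ≡-Reasoning

  Q : ℕ → ℕ → ℕ
  Q x y = x * x + 2 * (y * y)

  FiveOrSeven : ℕ → Set
  FiveOrSeven n = n ≡ 5 ⊎ n ≡ 7

  five-or-seven? : ∀ n → Dec (FiveOrSeven n)
  five-or-seven? n = n ≟ 5 ⊎-dec n ≟ 7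

  Q-shift-8 : ∀ r q s t →
    (r + q * 8) * (r + q * 8) + 2 * ((s + t * 8) * (s + t * 8))
      ≡ r * r + 2 * (s * s) + (2 * r * q + 8 * q * q + 4 * s * t + 16 * t * t) * 8
  Q-shift-8 = solve-∀

  Q-mod-8 : ∀ r q s t → Q (r + q * 8) (s + t * 8) % 8 ≡ Q r s % 8
  Q-mod-8 r q s t = trans (cong (_% 8) (Q-shift-8 r q s t))
    ([m+kn]%n≡m%n (Q r s) (2 * r * q + 8 * q * q + 4 * s * t + 16 * t * t) 8)

  Q-residues : ∀ (r s : Fin 8) → ¬ FiveOrSeven (Q (toℕ r) (toℕ s) % 8)
  Q-residues = from-yes $
    all? {n = 8} λ r → all? {n = 8} λ s → ¬? (five-or-seven? (Q (toℕ r) (toℕ s) % 8))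

  Q≢5,7-mod-8 : ∀ x y → ¬ FiveOrSeven (Q x y % 8)
  Q≢5,7-mod-8 x y = subst (λ n → ¬ FiveOrSeven n) Q-reduced≡Q (Q-residues (x mod 8) (y mod 8))
    where
    Q-reduced≡Q : Q (toℕ (x mod 8)) (toℕ (y mod 8)) % 8 ≡ Q x y % 8
    Q-reduced≡Q = begin
      Q (toℕ (x mod 8)) (toℕ (y mod 8)) % 8
        ≡⟨ cong₂ (λ r s → Q r s % 8) (toℕ-fromℕ< (m%n<n x 8)) (toℕ-fromℕ< (m%n<n y 8)) ⟩
      Q (x % 8) (y % 8) % 8
        ≡⟨ Q-mod-8 (x % 8) (x / 8) (y % 8) (y / 8) ⟨
      Q (x % 8 + x / 8 * 8) (y % 8 + y / 8 * 8) % 8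
        ≡⟨ cong₂ (λ x y → Q x y % 8) (m≡m%n+[m/n]*n x 8) (m≡m%n+[m/n]*n y 8) ⟨
      Q x y % 8
        ∎

  Q-double : ∀ q y → (q * 2) * (q * 2) + 2 * (y * y) ≡ 2 * (y * y + 2 * (q * q))
  Q-double = solve-∀

  2∣Q⇒2∣x : ∀ x y → 2 ∣ Q x y → 2 ∣ x
  2∣Q⇒2∣x x y 2∣Q = reduce (euclidsLemma x x (from-yes (prime? 2)) 2∣x*x)
    where
    2∣x*x : 2 ∣ x * x
    2∣x*x = ∣m+n∣m⇒∣n (subst (2 ∣_) (+-comm (x * x) (2 * (y * y))) 2∣Q) (m∣m*n (y * y))

  module Descent (m : ℕ) (Q≢m : ∀ {x y} → x ≢ 0 → y ≢ 0 → Q x y ≢ m) where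

    Q≢2^j*m : ∀ j {x y} → x ≢ 0 → y ≢ 0 → Q x y ≢ 2 ^ j * m
    Q≢2^j*m zero x≢0 y≢0 Q≡m = Q≢m x≢0 y≢0 (trans Q≡m (*-identityˡ m))
    Q≢2^j*m (suc j) {x} {y} x≢0 y≢0 Q≡2^[1+j]*m =
      halve (2∣Q⇒2∣x x y (divides (2 ^ j * m) (trans Q≡2*[2^j*m] (*-comm 2 (2 ^ j * m)))))
      where
      Q≡2*[2^j*m] : Q x y ≡ 2 * (2 ^ j * m)
      Q≡2*[2^j*m] = trans Q≡2^[1+j]*m (*-assoc 2 (2 ^ j) m)
      halve : 2 ∣ x → ⊥
      halve (divides q refl) = Q≢2^j*m j {y} {q} y≢0 (λ q≡0 → x≢0 (cong (_* 2) q≡0))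
        (*-cancelˡ-≡ _ _ 2 (trans (sym (Q-double q y)) Q≡2*[2^j*m]))

  Q≢1 : ∀ {x y} → x ≢ 0 → y ≢ 0 → Q x y ≢ 1
  Q≢1 {zero} x≢0 _ = contradiction refl x≢0
  Q≢1 {_} {zero} _ y≢0 = contradiction refl y≢0
  -- Q (suc x) (suc y) normalises to suc (_ + suc _).
  Q≢1 {suc x} {suc y} _ _ Q≡1 = m+1+n≢0 _ (suc-injective Q≡1)

  divisor-of-8 : ∀ k → k ∣ 8 → ∃[ j ] k ≡ 2 ^ j
  divisor-of-8 0 0∣8 = contradiction 0∣8 (from-no (0 ∣? 8))
  divisor-of-8 1 _   = 0 , refl
  divisor-of-8 2 _   = 1 , refl
  divisor-of-8 3 3∣8 = contradiction 3∣8 (from-no (3 ∣? 8))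
  divisor-of-8 4 _   = 2 , refl
  divisor-of-8 5 5∣8 = contradiction 5∣8 (from-no (5 ∣? 8))
  divisor-of-8 6 6∣8 = contradiction 6∣8 (from-no (6 ∣? 8))
  divisor-of-8 7 7∣8 = contradiction 7∣8 (from-no (7 ∣? 8))
  divisor-of-8 8 _   = 3 , refl
  divisor-of-8 (suc (suc (suc (suc (suc (suc (suc (suc (suc k))))))))) 9+k∣8 =
    contradiction (m+n≤o⇒m≤o 9 (∣⇒≤ 9+k∣8)) (from-no (9 ≤? 8))

  Q∤8 : ∀ {x y} → x ≢ 0 → y ≢ 0 → ¬ Q x y ∣ 8
  Q∤8 {x} {y} x≢0 y≢0 Q∣8 =
    let j , Q≡2^j = divisor-of-8 (Q x y) Q∣8 in
    Descent.Q≢2^j*m 1 Q≢1 j x≢0 y≢0 (trans Q≡2^j (sym (*-identityʳ (2 ^ j))))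

  prime∤⇒coprime : ∀ {p n} → Prime p → ¬ p ∣ n → Coprime n p
  prime∤⇒coprime pr p∤n {d} (d∣n , d∣p) with prime⇒irreducible pr d∣p
  ... | inj₁ d≡1 = d≡1
  ... | inj₂ refl = contradiction d∣n p∤n

  ∣*prime⇒∣⊎≡*prime : ∀ {p m n} → Prime p → n ∣ m * p → n ∣ m ⊎ ∃[ k ] k ∣ m × n ≡ k * p
  ∣*prime⇒∣⊎≡*prime {p} {m} {n} pr n∣m*p with p ∣? n
  ... | yes (divides k n≡k*p) =
    inj₂ (k , *-cancelʳ-∣ p {{prime⇒nonZero pr}} (subst (_∣ m * p) n≡k*p n∣m*p) , n≡k*p)
  ... | no p∤n = inj₁ (coprime-divisor (prime∤⇒coprime pr p∤n) (subst (n ∣_) (*-comm m p) n∣m*p))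

  coprime-*ˡ : ∀ {m n o} → Coprime m o → Coprime n o → Coprime (m * n) o
  coprime-*ˡ {m} m⊥o n⊥o {d} (d∣m*n , d∣o) = n⊥o (coprime-divisor d⊥m d∣m*n , d∣o)
    where
    d⊥m : Coprime d m
    d⊥m (e∣d , e∣m) = m⊥o (e∣m , ∣-trans e∣d d∣o)

  coprime-square : ∀ {m n} → Coprime m n → Coprime (m * m) (n * n)
  coprime-square {m} {n} m⊥n = coprime-*ˡ m⊥n² m⊥n²
    where
    m⊥n² : Coprime m (n * n)
    m⊥n² = Coprimality.sym (coprime-*ˡ (Coprimality.sym m⊥n) (Coprimality.sym m⊥n))

  Q-scale : ∀ α β g →
    (α * g) * (α * g) + 2 * ((β * g) * (β * g)) ≡ (α * α + 2 * (β * β)) * (g * g)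
  Q-scale = solve-∀

  square-scale : ∀ γ g m → (γ * g) * (γ * g) * m ≡ γ * γ * m * (g * g)
  square-scale = solve-∀

  Q-cancel-common-factor : ∀ {α β γ m} g .{{_ : NonZero g}} →
    Q (α * g) (β * g) ∣ (γ * g) * (γ * g) * m → Q α β ∣ γ * γ * m
  Q-cancel-common-factor {α} {β} {γ} {m} g Q∣γ²m =
    *-cancelʳ-∣ (g * g) {{m*n≢0 g g}} (subst₂ _∣_ (Q-scale α β g) (square-scale γ g m) Q∣γ²m)

  primitive-reduction : ∀ {t s m} → t ≢ 0 → s ≢ 0 → Q t s ∣ t * t * m → Q t s ∣ s * s * m →
    ∃[ α ] ∃[ β ] α ≢ 0 × β ≢ 0 × Q α β ∣ m
  primitive-reduction {t} {s} {m} t≢0 s≢0 Q∣t²m Q∣s²m =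
    α , β , (λ α≡0 → t≢0 (trans (sym αg≡t) (cong (_* g) α≡0))) ,
            (λ β≡0 → s≢0 (trans (sym βg≡s) (cong (_* g) β≡0))) ,
    coprime-factors (coprime-square (coprime-/gcd t s))
      ( Q-cancel-common-factor {α} {β} {α} g
          (subst₂ (λ t s → Q t s ∣ t * t * m) (sym αg≡t) (sym βg≡s) Q∣t²m)
      , Q-cancel-common-factor {α} {β} {β} g
          (subst₂ (λ t s → Q t s ∣ s * s * m) (sym αg≡t) (sym βg≡s) Q∣s²m))
    where
    g : ℕ
    g = gcd t s
    instance
      g≢0 : NonZero g
      g≢0 = ≢-nonZero (gcd[m,n]≢0 t s (inj₁ t≢0))
    α β : ℕ
    α = t / g
    β = s / g
    αg≡t : α * g ≡ t
    αg≡t = m/n*n≡m (gcd[m,n]∣m t s)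
    βg≡s : β * g ≡ s
    βg≡s = m/n*n≡m (gcd[m,n]∣n t s)

  module _ {p} (pr : Prime p) (p≡5,7 : FiveOrSeven (p % 8)) where

    Q≢p : ∀ {x y} → Q x y ≢ p
    Q≢p {x} {y} Q≡p = Q≢5,7-mod-8 x y (subst (λ n → FiveOrSeven (n % 8)) (sym Q≡p) p≡5,7)

    Q≢k*p : ∀ {k x y} → k ∣ 8 → x ≢ 0 → y ≢ 0 → Q x y ≢ k * p
    Q≢k*p {k} k∣8 x≢0 y≢0 Q≡k*p with divisor-of-8 k k∣8
    ... | j , refl = Descent.Q≢2^j*m p (λ {x} {y} _ _ → Q≢p {x} {y}) j x≢0 y≢0 Q≡k*p

    Q∤8*p : ∀ {x y} → x ≢ 0 → y ≢ 0 → ¬ Q x y ∣ 8 * p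
    Q∤8*p {x} {y} x≢0 y≢0 Q∣8p with ∣*prime⇒∣⊎≡*prime pr Q∣8p
    ... | inj₁ Q∣8 = Q∤8 {x} {y} x≢0 y≢0 Q∣8
    ... | inj₂ (k , k∣8 , Q≡k*p) = Q≢k*p {k} {x} {y} k∣8 x≢0 y≢0 Q≡k*p

    no-nonzero-Q-divisor : ∀ {t s} → t ≢ 0 → s ≢ 0 →
      Q t s ∣ t * t * (8 * p) → Q t s ∣ s * s * (8 * p) → ⊥
    no-nonzero-Q-divisor {t} {s} t≢0 s≢0 Q∣t²8p Q∣s²8p =
      let α , β , α≢0 , β≢0 , Q∣8p = primitive-reduction {t} {s} t≢0 s≢0 Q∣t²8p Q∣s²8p in
      Q∤8*p {α} {β} α≢0 β≢0 Q∣8p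

open QuadraticForm using (Q; FiveOrSeven; no-nonzero-Q-divisor)

open import Data.Integer using (ℤ; +_; -_; _*_; _+_; _-_; 0ℤ; ∣_∣; -[1+_]; _≟_)
open import Data.Integer.Properties
  using (abs-*; pos-*; ∣i∣≡0⇒i≡0; i*j≡0⇒i≡0∨j≡0; i-j≡0⇒i≡j; +-identityˡ; +-identityʳ; +-inverseʳ;
         +-0-abelianGroup)
open import Algebra.Properties.AbelianGroup +-0-abelianGroup using (inverseˡ-unique; inverseʳ-unique)
import Data.Integer.Divisibility.Signed as Signed
open import Data.Integer.Tactic.RingSolver using (solve)
import Data.Nat as ℕ
import Data.Nat.Properties as ℕₚ
open import Data.Nat.Divisibility using (_∣_)
open ≡-Reasoning

i*i≡+∣i∣*∣i∣ : ∀ i → i * i ≡ + (∣ i ∣ ℕ.* ∣ i ∣)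
i*i≡+∣i∣*∣i∣ (+ n)    = sym (pos-* n n)
i*i≡+∣i∣*∣i∣ -[1+ n ] = refl

T²+2S²≡+Q∣T∣∣S∣ : ∀ T S → T * T + + 2 * (S * S) ≡ + Q (∣ T ∣) (∣ S ∣)
T²+2S²≡+Q∣T∣∣S∣ T S = begin
  T * T + + 2 * (S * S)
    ≡⟨ cong₂ (λ t s → t + + 2 * s) (i*i≡+∣i∣*∣i∣ T) (i*i≡+∣i∣*∣i∣ S) ⟩
  + (∣ T ∣ ℕ.* ∣ T ∣) + + 2 * + (∣ S ∣ ℕ.* ∣ S ∣)
    ≡⟨ cong (_+_ (+ (∣ T ∣ ℕ.* ∣ T ∣))) (sym (pos-* 2 (∣ S ∣ ℕ.* ∣ S ∣))) ⟩
  + Q (∣ T ∣) (∣ S ∣)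
    ∎

-- Δ (a − d) b c is the discriminant tr² − 4 det of the matrix (a b; c d).
Δ : ℤ → ℤ → ℤ → ℤ
Δ u b c = u * u + + 4 * (b * c)

discriminant-relation : ∀ {T S u v b c f g} →
  T * u + + 2 * (S * v) ≡ 0ℤ → T * b + + 2 * (S * f) ≡ 0ℤ → T * c + + 2 * (S * g) ≡ 0ℤ →
  T * T * Δ u b c ≡ + 4 * (S * S * Δ v f g)
discriminant-relation {T} {S} {u} {v} {b} {c} {f} {g} rel-u rel-b rel-c = begin
  T * T * (u * u + + 4 * (b * c))
    ≡⟨ solve (T ∷ u ∷ b ∷ c ∷ []) ⟩
  (T * u) * (T * u) + + 4 * ((T * b) * (T * c))
    ≡⟨ cong₂ (λ x y → x * x + + 4 * y) Tu≡-2Sv (cong₂ _*_ Tb≡-2Sf Tc≡-2Sg) ⟩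
  - (+ 2 * (S * v)) * - (+ 2 * (S * v)) + + 4 * (- (+ 2 * (S * f)) * - (+ 2 * (S * g)))
    ≡⟨ solve (S ∷ v ∷ f ∷ g ∷ []) ⟩
  + 4 * (S * S * (v * v + + 4 * (f * g)))
    ∎
  where
  Tu≡-2Sv : T * u ≡ - (+ 2 * (S * v))
  Tu≡-2Sv = inverseˡ-unique (T * u) (+ 2 * (S * v)) rel-u
  Tb≡-2Sf : T * b ≡ - (+ 2 * (S * f))
  Tb≡-2Sf = inverseˡ-unique (T * b) (+ 2 * (S * f)) rel-b
  Tc≡-2Sg : T * c ≡ - (+ 2 * (S * g))
  Tc≡-2Sg = inverseˡ-unique (T * c) (+ 2 * (S * g)) rel-c

module _ {T S Δx Δy N : ℤ} (disc : T * T * Δx ≡ + 4 * (S * S * Δy))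
         (trace : T * T + Δx + + 2 * (S * S + Δy) ≡ + 4 * N) where

  T²+2S²∣8NT² : (T * T + + 2 * (S * S)) Signed.∣ T * T * (+ 8 * N)
  T²+2S²∣8NT² = Signed.divides (+ 2 * (T * T + + 2 * Δy)) $ begin
    T * T * (+ 8 * N)
      ≡⟨ solve (T ∷ N ∷ []) ⟩
    + 2 * (T * T * (+ 4 * N))
      ≡⟨ cong (λ z → + 2 * (T * T * z)) trace ⟨
    + 2 * (T * T * (T * T + Δx + + 2 * (S * S + Δy)))
      ≡⟨ solve (T ∷ S ∷ Δx ∷ Δy ∷ []) ⟩
    + 2 * (T * T * (T * T + + 2 * (S * S + Δy))) + + 2 * (T * T * Δx)
      ≡⟨ cong (λ z → + 2 * (T * T * (T * T + + 2 * (S * S + Δy))) + + 2 * z) disc ⟩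
    + 2 * (T * T * (T * T + + 2 * (S * S + Δy))) + + 2 * (+ 4 * (S * S * Δy))
      ≡⟨ solve (T ∷ S ∷ Δy ∷ []) ⟩
    + 2 * (T * T + + 2 * Δy) * (T * T + + 2 * (S * S))
      ∎

  T²+2S²∣8NS² : (T * T + + 2 * (S * S)) Signed.∣ S * S * (+ 8 * N)
  T²+2S²∣8NS² = Signed.divides (+ 2 * (S * S) + Δx) $ begin
    S * S * (+ 8 * N)
      ≡⟨ solve (S ∷ N ∷ []) ⟩
    + 2 * (S * S) * (+ 4 * N)
      ≡⟨ cong (λ z → + 2 * (S * S) * z) trace ⟨
    + 2 * (S * S) * (T * T + Δx + + 2 * (S * S + Δy))
      ≡⟨ solve (T ∷ S ∷ Δx ∷ Δy ∷ []) ⟩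
    (+ 2 * (S * S) + Δx) * (T * T + + 2 * (S * S)) + (+ 4 * (S * S * Δy) - T * T * Δx)
      ≡⟨ cong (λ z → (+ 2 * (S * S) + Δx) * (T * T + + 2 * (S * S)) + (+ 4 * (S * S * Δy) - z)) disc ⟩
    (+ 2 * (S * S) + Δx) * (T * T + + 2 * (S * S)) + (+ 4 * (S * S * Δy) - + 4 * (S * S * Δy))
      ≡⟨ solve (T ∷ S ∷ Δx ∷ Δy ∷ []) ⟩
    (+ 2 * (S * S) + Δx) * (T * T + + 2 * (S * S))
      ∎

T²+2S²∣R²8N⇒Q∣R²8p : ∀ {p N} T S R → ∣ N ∣ ≡ p →
  (T * T + + 2 * (S * S)) Signed.∣ R * R * (+ 8 * N) →
  Q (∣ T ∣) (∣ S ∣) ∣ ∣ R ∣ ℕ.* ∣ R ∣ ℕ.* (8 ℕ.* p)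
T²+2S²∣R²8N⇒Q∣R²8p {p} {N} T S R ∣N∣≡p T²+2S²∣R²8N =
  subst₂ _∣_ (cong ∣_∣ (T²+2S²≡+Q∣T∣∣S∣ T S)) ∣R²8N∣≡∣R∣²8p (Signed.∣⇒∣ᵤ T²+2S²∣R²8N)
  where
  ∣R²8N∣≡∣R∣²8p : ∣ R * R * (+ 8 * N) ∣ ≡ ∣ R ∣ ℕ.* ∣ R ∣ ℕ.* (8 ℕ.* p)
  ∣R²8N∣≡∣R∣²8p = trans (abs-* (R * R) (+ 8 * N))
    (cong₂ ℕ._*_ (abs-* R R) (trans (abs-* (+ 8) N) (cong (8 ℕ.*_) ∣N∣≡p)))

module _ {p} (pr : Prime p) (p≡5,7 : FiveOrSeven (p % 8)) where

  nonzero-traces-impossible : ∀ {T S u v b c f g N} → ∣ N ∣ ≡ p → T ≢ 0ℤ → S ≢ 0ℤ →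
    T * u + + 2 * (S * v) ≡ 0ℤ → T * b + + 2 * (S * f) ≡ 0ℤ → T * c + + 2 * (S * g) ≡ 0ℤ →
    T * T + Δ u b c + + 2 * (S * S + Δ v f g) ≡ + 4 * N → ⊥
  nonzero-traces-impossible {T} {S} {u} {v} {b} {c} {f} {g} {N}
                            ∣N∣≡p T≢0 S≢0 rel-u rel-b rel-c trace =
    no-nonzero-Q-divisor pr p≡5,7 ∣T∣≢0 ∣S∣≢0
      (T²+2S²∣R²8N⇒Q∣R²8p T S T ∣N∣≡p (T²+2S²∣8NT² {T} {S} {Δ u b c} {Δ v f g} disc trace))
      (T²+2S²∣R²8N⇒Q∣R²8p T S S ∣N∣≡p (T²+2S²∣8NS² {T} {S} {Δ u b c} {Δ v f g} disc trace))
    where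
    disc : T * T * Δ u b c ≡ + 4 * (S * S * Δ v f g)
    disc = discriminant-relation {T} {S} {u} {v} {b} {c} {f} {g} rel-u rel-b rel-c
    ∣T∣≢0 : ∣ T ∣ ≢ 0
    ∣T∣≢0 ∣T∣≡0 = T≢0 (∣i∣≡0⇒i≡0 ∣T∣≡0)
    ∣S∣≢0 : ∣ S ∣ ≢ 0
    ∣S∣≢0 ∣S∣≡0 = S≢0 (∣i∣≡0⇒i≡0 ∣S∣≡0)

2*[i*j]≡0⇒i≡0∨j≡0 : ∀ i {j} → + 2 * (i * j) ≡ 0ℤ → i ≡ 0ℤ ⊎ j ≡ 0ℤ
2*[i*j]≡0⇒i≡0∨j≡0 i 2ij≡0 = [ (λ ()) , i*j≡0⇒i≡0∨j≡0 i ]′ (i*j≡0⇒i≡0∨j≡0 (+ 2) 2ij≡0)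

T≡0⇒y≡0 : ∀ {T S x y} → T * x + + 2 * (S * y) ≡ 0ℤ → T ≡ 0ℤ → S ≢ 0ℤ → y ≡ 0ℤ
T≡0⇒y≡0 {S = S} rel refl S≢0 =
  [ (λ S≡0 → contradiction S≡0 S≢0) , id ]′ (2*[i*j]≡0⇒i≡0∨j≡0 S (trans (sym (+-identityˡ _)) rel))

S≡0⇒x≡0 : ∀ {T S x y} → T * x + + 2 * (S * y) ≡ 0ℤ → S ≡ 0ℤ → T ≢ 0ℤ → x ≡ 0ℤ
S≡0⇒x≡0 {T = T} rel refl T≢0 =
  [ (λ T≡0 → contradiction T≡0 T≢0) , id ]′ (i*j≡0⇒i≡0∨j≡0 T (trans (sym (+-identityʳ _)) rel))

mat-≡ : ∀ {a b c d a′ b′ c′ d′} → a ≡ a′ → b ≡ b′ → c ≡ c′ → d ≡ d′ → mat a b c d ≡ mat a′ b′ c′ d′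
mat-≡ refl refl refl refl = refl

trace-zero⇒tl : ∀ {a b c d} → a + d ≡ 0ℤ → mat a b c d ≡ tl a b c
trace-zero⇒tl {a} {b} {c} {d} a+d≡0 = cong (mat a b c) (inverseʳ-unique a d a+d≡0)

sq-tl : ∀ t₁ t₂ t₃ → sq (tl t₁ t₂ t₃) ≡ scalarI (t₁ * t₁ + t₂ * t₃)
sq-tl t₁ t₂ t₃ = mat-≡ refl upper lower diagonal
  where
  upper : t₁ * t₂ + t₂ * - t₁ ≡ 0ℤ
  upper = solve (t₁ ∷ t₂ ∷ [])
  lower : t₃ * t₁ + - t₁ * t₃ ≡ 0ℤ
  lower = solve (t₁ ∷ t₃ ∷ [])
  diagonal : t₃ * t₂ + - t₁ * - t₁ ≡ t₁ * t₁ + t₂ * t₃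
  diagonal = solve (t₁ ∷ t₂ ∷ t₃ ∷ [])

sq-scalarI : ∀ t → sq (scalarI t) ≡ scalarI (t * t)
sq-scalarI t = mat-≡ (+-identityʳ (t * t)) upper lower (+-identityˡ (t * t))
  where
  upper : t * 0ℤ + 0ℤ * t ≡ 0ℤ
  upper = solve (t ∷ [])
  lower : 0ℤ * t + t * 0ℤ ≡ 0ℤ
  lower = solve (t ∷ [])

scalar-combination : ∀ X Y {x y} → sq X ≡ scalarI x → sq Y ≡ scalarI y →
  sq X ⊕ ((+ 2) · sq Y) ≡ scalarI (x + + 2 * y)
scalar-combination X Y X²≡x Y²≡y = cong₂ (λ A B → A ⊕ ((+ 2) · B)) X²≡x Y²≡y

backward : ∀ {N} X Y → FormI N X Y ⊎ FormII N X Y ⊎ FormIII N X Y →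
  sq X ⊕ ((+ 2) · sq Y) ≡ scalarI N
backward X Y (inj₁ (t₁ , t₂ , t₃ , s₁ , s₂ , s₃ , refl , refl , eq)) =
  trans (scalar-combination X Y (sq-tl t₁ t₂ t₃) (sq-tl s₁ s₂ s₃)) (cong scalarI eq)
backward X Y (inj₂ (inj₁ (t₁ , t₂ , t₃ , t₄ , refl , refl , eq))) =
  trans (scalar-combination X Y (sq-scalarI t₁) (sq-tl t₄ t₂ t₃)) (cong scalarI eq)
backward X Y (inj₂ (inj₂ (t₁ , t₂ , t₃ , t₄ , refl , refl , eq))) =
  trans (scalar-combination X Y (sq-tl t₁ t₂ t₃) (sq-scalarI t₄)) (cong scalarI eq)

module EntryRelations {a b c d e f g h N : ℤ}
  (H : sq (mat a b c d) ⊕ ((+ 2) · sq (mat e f g h)) ≡ scalarI N) where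

  upper-left : a * a + b * c + + 2 * (e * e + f * g) ≡ N
  upper-left = cong M₂.a H

  diagonal-relation : (a + d) * (a - d) + + 2 * ((e + h) * (e - h)) ≡ 0ℤ
  diagonal-relation = begin
    (a + d) * (a - d) + + 2 * ((e + h) * (e - h))
      ≡⟨ solve (a ∷ b ∷ c ∷ d ∷ e ∷ f ∷ g ∷ h ∷ []) ⟩
    (a * a + b * c + + 2 * (e * e + f * g)) - (c * b + d * d + + 2 * (g * f + h * h))
      ≡⟨ cong₂ _-_ upper-left (cong M₂.d H) ⟩
    N - N
      ≡⟨ +-inverseʳ N ⟩
    0ℤ ∎

  upper-relation : (a + d) * b + + 2 * ((e + h) * f) ≡ 0ℤ
  upper-relation = begin
    (a + d) * b + + 2 * ((e + h) * f)     ≡⟨ solve (a ∷ b ∷ d ∷ e ∷ f ∷ h ∷ []) ⟩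
    a * b + b * d + + 2 * (e * f + f * h) ≡⟨ cong M₂.b H ⟩
    0ℤ                                    ∎

  lower-relation : (a + d) * c + + 2 * ((e + h) * g) ≡ 0ℤ
  lower-relation = begin
    (a + d) * c + + 2 * ((e + h) * g)     ≡⟨ solve (a ∷ c ∷ d ∷ e ∷ g ∷ h ∷ []) ⟩
    c * a + d * c + + 2 * (g * e + h * g) ≡⟨ cong M₂.c H ⟩
    0ℤ                                    ∎

  trace-relation :
    (a + d) * (a + d) + Δ (a - d) b c + + 2 * ((e + h) * (e + h) + Δ (e - h) f g) ≡ + 4 * N
  trace-relation = begin
    (a + d) * (a + d) + ((a - d) * (a - d) + + 4 * (b * c))
      + + 2 * ((e + h) * (e + h) + ((e - h) * (e - h) + + 4 * (f * g)))
      ≡⟨ solve (a ∷ b ∷ c ∷ d ∷ e ∷ f ∷ g ∷ h ∷ []) ⟩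
    + 2 * ((a * a + b * c + + 2 * (e * e + f * g)) + (c * b + d * d + + 2 * (g * f + h * h)))
      ≡⟨ cong (λ z → + 2 * z) (cong₂ _+_ upper-left (cong M₂.d H)) ⟩
    + 2 * (N + N)
      ≡⟨ solve (N ∷ []) ⟩
    + 4 * N ∎

traceless-form : ∀ {a b c d e f g h N} → a + d ≡ 0ℤ → e + h ≡ 0ℤ →
  a * a + b * c + + 2 * (e * e + f * g) ≡ N → FormI N (mat a b c d) (mat e f g h)
traceless-form {a} {b} {c} {e = e} {f} {g} T≡0 S≡0 eq =
  a , b , c , e , f , g , trace-zero⇒tl T≡0 , trace-zero⇒tl S≡0 , eq

scalar-X-form : ∀ {a b c d e f g h N} → b ≡ 0ℤ → c ≡ 0ℤ → a ≡ d → e + h ≡ 0ℤ →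
  a * a + b * c + + 2 * (e * e + f * g) ≡ N → FormII N (mat a b c d) (mat e f g h)
scalar-X-form {a} {e = e} {f} {g} refl refl refl S≡0 eq =
  a , f , g , e , refl , trace-zero⇒tl S≡0 ,
  trans (cong (λ z → z + + 2 * (e * e + f * g)) (sym (+-identityʳ (a * a)))) eq

scalar-Y-form : ∀ {a b c d e f g h N} → a + d ≡ 0ℤ → f ≡ 0ℤ → g ≡ 0ℤ → e ≡ h →
  a * a + b * c + + 2 * (e * e + f * g) ≡ N → FormIII N (mat a b c d) (mat e f g h)
scalar-Y-form {a} {b} {c} {e = e} T≡0 refl refl refl eq =
  a , b , c , e , trace-zero⇒tl T≡0 , refl ,
  trans (cong (λ z → a * a + b * c + + 2 * z) (sym (+-identityʳ (e * e)))) eq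

forward : ∀ {p} → Prime p → FiveOrSeven (p % 8) → ∀ {N} X Y → ∣ N ∣ ≡ p →
  sq X ⊕ ((+ 2) · sq Y) ≡ scalarI N → FormI N X Y ⊎ FormII N X Y ⊎ FormIII N X Y
forward pr p≡5,7 {N} (mat a b c d) (mat e f g h) ∣N∣≡p H = by-traces (a + d ≟ 0ℤ) (e + h ≟ 0ℤ)
  where
  open EntryRelations {a} {b} {c} {d} {e} {f} {g} {h} H
  X Y : M₂
  X = mat a b c d
  Y = mat e f g h
  by-traces : Dec (a + d ≡ 0ℤ) → Dec (e + h ≡ 0ℤ) → FormI N X Y ⊎ FormII N X Y ⊎ FormIII N X Y
  by-traces (yes T≡0) (yes S≡0) = inj₁ (traceless-form T≡0 S≡0 upper-left)
  by-traces (yes T≡0) (no S≢0) = inj₂ (inj₂ (scalar-Y-form T≡0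
    (T≡0⇒y≡0 upper-relation T≡0 S≢0) (T≡0⇒y≡0 lower-relation T≡0 S≢0)
    (i-j≡0⇒i≡j e h (T≡0⇒y≡0 diagonal-relation T≡0 S≢0)) upper-left))
  by-traces (no T≢0) (yes S≡0) = inj₂ (inj₁ (scalar-X-form
    (S≡0⇒x≡0 upper-relation S≡0 T≢0) (S≡0⇒x≡0 lower-relation S≡0 T≢0)
    (i-j≡0⇒i≡j a d (S≡0⇒x≡0 diagonal-relation S≡0 T≢0)) S≡0 upper-left))
  by-traces (no T≢0) (no S≢0) = ⊥-elim (nonzero-traces-impossible pr p≡5,7 ∣N∣≡p T≢0 S≢0
    diagonal-relation upper-relation lower-relation trace-relation)

∣±1*n∣≡n : ∀ {ε} n → ε ≡ + 1 ⊎ ε ≡ - + 1 → ∣ ε * + n ∣ ≡ n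
∣±1*n∣≡n {ε} n ε≡±1 =
  trans (abs-* ε (+ n)) (trans (cong (ℕ._* n) ([ cong ∣_∣ , cong ∣_∣ ]′ ε≡±1)) (ℕₚ.*-identityˡ n))

proposition4p2 : (p : ℕ) → Prime p → (p % 8 ≡ 5 ⊎ p % 8 ≡ 7) →
    (ε : ℤ) → (ε ≡ + 1 ⊎ ε ≡ - + 1) → (X Y : M₂) →
    ((sq X ⊕ ((+ 2) · sq Y)) ≡ scalarI (ε * + p)
      ⇔ (FormI (ε * + p) X Y ⊎ FormII (ε * + p) X Y ⊎ FormIII (ε * + p) X Y))
proposition4p2 p pr p≡5,7 ε ε≡±1 X Y =
  mk⇔ (forward pr p≡5,7 X Y (∣±1*n∣≡n p ε≡±1)) (backward X Y)
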